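{- Let $\Gamma$ be a dicycle of even order $n\ge4$, with vertices $1,\dots,n$ and edges $(1,2),(2,3),\dots,(n-1,n),(n,1)$ (up to relabeling, starting from any vertex). Construct $\Gamma'$ from $\Gamma$ by performing a twin splitting on each of the vertices $1,3,5,\dots,n-1$ (every other vertex of the dicycle), and let $T$ be the set of $n$ vertices consisting of these split vertices together with their new copies. Construct $\Gamma''$ from $\Gamma'$ by adding a new vertex $v$ together with the edges $(v,t)$ and $(t,v)$ for every $t\in T$. Then $\Gamma'$ is a balanced digraph that is not normal, and $\Gamma''$ is a normal digraph.
   Context: Digraphs are finite, simple (no loops) and unweighted. The twin splitting of a vertex $w$ of a digraph $(V,E)$ adds a new vertex $w'$ (not adjacent to $w$) such that for all other vertices $u$, $(u,w')$ is an edge iff $(u,w)$ is an edge, and $(w',u)$ is an edge iff $(w,u)$ is an edge. The Laplacian is $L=D-A$ with $A$ the adjacency matrix and $D$ the diagonal matrix of out-degrees. A digraph is normal if $L$ is a normal matrix, and balanced if every vertex has in-degree equal to out-degree. -}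

module Defs where

open import Data.Bool using (Bool; true; false; if_then_else_; _∨_; _∧_; not)
open import Data.Nat using (ℕ; zero; suc; _≡ᵇ_; _%_)
open import Data.Integer as ℤ using (ℤ; +_)
open import Data.Fin using (Fin; zero; suc; toℕ; inject₁; fromℕ)
open import Data.List using (List; []; _∷_; filterᵇ; allFin)
open import Data.Product using (Σ; _×_; _,_; proj₁; proj₂)
open import Relation.Binary.PropositionalEquality using (_≡_)

-- A (finite) digraph: vertex set Fin size, adjacency as a Boolean relation.
-- adj i j = true means (i , j) is an edge.  All digraphs built below are loopless.
record Digraph : Set where
  constructor digraph
  field
    size : ℕ
    adj  : Fin size → Fin size → Bool
open Digraph public

_==_ : ∀ {m} → Fin m → Fin m → Bool
i == j = toℕ i ≡ᵇ toℕ j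

sumℕ : ∀ m → (Fin m → ℕ) → ℕ
sumℕ zero    f = 0
sumℕ (suc m) f = f zero Data.Nat.+ sumℕ m (λ i → f (suc i))

sumℤ : ∀ m → (Fin m → ℤ) → ℤ
sumℤ zero    f = + 0
sumℤ (suc m) f = f zero ℤ.+ sumℤ m (λ i → f (suc i))

b2n : Bool → ℕ
b2n true  = 1
b2n false = 0

outdeg : (G : Digraph) → Fin (size G) → ℕ
outdeg G i = sumℕ (size G) (λ j → b2n (adj G i j))

indeg : (G : Digraph) → Fin (size G) → ℕ
indeg G i = sumℕ (size G) (λ j → b2n (adj G j i))

Balanced : Digraph → Set
Balanced G = ∀ i → indeg G i ≡ outdeg G i

Matrix : ℕ → Set
Matrix m = Fin m → Fin m → ℤ

laplacian : (G : Digraph) → Matrix (size G)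
laplacian G i j =
  (if i == j then + outdeg G i else + 0) ℤ.- (+ b2n (adj G i j))

transpose : ∀ {m} → Matrix m → Matrix m
transpose M i j = M j i

_⊗_ : ∀ {m} → Matrix m → Matrix m → Matrix m
_⊗_ {m} M N i j = sumℤ m (λ k → M i k ℤ.* N k j)

-- normal: L Lᵀ = Lᵀ L  (L is real, so L* = Lᵀ)
Normal : Digraph → Set
Normal G = ∀ i j → (L ⊗ transpose L) i j ≡ (transpose L ⊗ L) i j
  where L = laplacian G

-- dicycle on n vertices: vertex 1,...,n is index 0,...,n-1;
-- edges (i, i+1) and (n, 1)
dicycle : ℕ → Digraph
dicycle n = digraph n (λ i j → toℕ j ≡ᵇ nxt (toℕ i))
  where
  nxt : ℕ → ℕ
  nxt i = if suc i ≡ᵇ n then 0 else suc i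

-- twin splitting of w: new vertex w' = fromℕ (size G), old vertices via inject₁.
-- We split on the lift of old vertices: classify a vertex of the new graph.
data View (m : ℕ) : Fin (suc m) → Set where
  old : (x : Fin m) → View m (inject₁ x)
  new : View m (fromℕ m)

view : ∀ m (x : Fin (suc m)) → View m x
view zero    zero    = new
view (suc m) zero    = old zero
view (suc m) (suc x) with view m x
... | old y = old (suc y)
... | new   = new

twinSplit : (G : Digraph) → Fin (size G) → Digraph
twinSplit G w = digraph (suc (size G)) e
  where
  e : Fin (suc (size G)) → Fin (suc (size G)) → Bool
  e x y with view (size G) x | view (size G) y
  ... | old a | old b = adj G a b
  ... | old a | new   = adj G a w
  ... | new   | old b = adj G w b
  ... | new   | new   = false

Marked : Set
Marked = Σ Digraph (λ G → Fin (size G) → Bool)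

splitMark : (H : Marked) → Fin (size (proj₁ H)) → Marked
splitMark (G , M) w = twinSplit G w , M'
  where
  M' : Fin (suc (size G)) → Bool
  M' x with view (size G) x
  ... | old a = M a ∨ (a == w)
  ... | new   = true

-- successively twin split the listed vertices (vertices of the original graph,
-- tracked through the embedding into the growing graph)
splitAll : (G : Digraph) → List (Fin (size G)) → Marked
splitAll G ws = go (G , λ _ → false) (λ x → x) ws
  where
  go : (H : Marked) → (Fin (size G) → Fin (size (proj₁ H))) → List (Fin (size G)) → Marked
  go H e []       = H
  go H e (w ∷ ws) = go (splitMark H (e w)) (λ x → inject₁ (e x)) ws

addCone : Marked → Digraph
addCone (G , T) = digraph (suc (size G)) e
  where
  e : Fin (suc (size G)) → Fin (suc (size G)) → Bool
  e x y with view (size G) x | view (size G) y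
  ... | old a | old b = adj G a b
  ... | old a | new   = T a
  ... | new   | old b = T b
  ... | new   | new   = false

-- vertices 1,3,5,...,n-1 of the dicycle (indices 0,2,...,n-2)
oddVertices : (n : ℕ) → List (Fin n)
oddVertices n = filterᵇ (λ i → (toℕ i % 2) ≡ᵇ 0) (allFin n)

Γ'T : ℕ → Marked
Γ'T n = splitAll (dicycle n) (oddVertices n)

Γ' : ℕ → Digraph
Γ' n = proj₁ (Γ'T n)

Γ'' : ℕ → Digraph
Γ'' n = addCone (Γ'T n)

{-# OPTIONS --safe #-}
module Submission where

-- Write n = 2m and number the dicycle 0, …, n − 1, so that the split vertices are the even ones.
-- Γ′ is the blow-up of the dicycle in which every even vertex gets two independent copies: the
-- out-degree of a vertex is the number of copies of its successor and its in-degree the number of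
-- copies of its predecessor.  As n is even, successor and predecessor have the same parity, so Γ′
-- is balanced, and for the same reason any two vertices have as many common out-neighbours as
-- common in-neighbours.  For L = D − A, (LLᵀ)ᵢⱼ = (LᵀL)ᵢⱼ amounts to
--   c⁺ᵢⱼ + dᵢaᵢⱼ + dⱼaⱼᵢ = c⁻ᵢⱼ + dᵢaⱼᵢ + dⱼaᵢⱼ   (c± counting common out-/in-neighbours),
-- which fails on the arc 0 → 1 of Γ′, where d₀ = 1 and d₁ = 2.  In Γ″ the apex joined both ways
-- to the split vertices raises every other out-degree to exactly 2 and keeps the common-neighbour
-- counts equal, so the identity holds for every pair of vertices.

open import Defs
import Algebra.Properties.CommutativeSemigroup as CommSemigroupProperties
open import Data.Bool using (Bool; true; false; not; _∨_; _∧_; if_then_else_; T)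
open import Data.Bool.ListAction using (any)
open import Data.Bool.Properties
  using (∨-assoc; ∨-identityʳ; ∨-zeroʳ; ∧-zeroʳ; ∧-identityʳ; not-involutive; ⇔→≡)
open import Data.Fin using (Fin; zero; suc; toℕ; inject₁; fromℕ; fromℕ<)
import Data.Fin.Properties as Fin
open import Data.Fin.Properties using (toℕ-inject₁; toℕ-fromℕ; toℕ-fromℕ<; toℕ<n)
open import Data.Integer as ℤ using (ℤ; +_)
import Data.Integer.Properties as ℤP
open import Data.Integer.Tactic.RingSolver using (solve-∀)
open import Data.List using (List; []; _∷_; map; length; filterᵇ; allFin; applyUpTo; upTo; tabulate)
open import Data.List.Properties using (map-tabulate; length-map; length-applyUpTo)
open import Data.Nat as ℕ using (ℕ; zero; suc; _+_; _*_; _∸_; _%_; _≡ᵇ_; _<ᵇ_; _<_; _≤_; z≤n; s≤s)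
open import Data.Nat.Divisibility using (_∣_; divides)
open import Data.Nat.Properties
open import Data.Product using (_×_; _,_; proj₁; proj₂)
open import Data.Sum using (_⊎_; inj₁; inj₂)
open import Data.Unit using (⊤)
open import Function using (_∘_; _⇔_; mk⇔; Equivalence)
open import Relation.Binary.PropositionalEquality
open import Relation.Nullary using (¬_; yes; no; contradiction)
open import Relation.Nullary.Decidable using (dec-true; dec-false)

open CommSemigroupProperties +-commutativeSemigroup using () renaming (interchange to +-interchange)
open CommSemigroupProperties *-commutativeSemigroup using () renaming (x∙yz≈y∙xz to *-left-comm)
open CommSemigroupProperties ℤP.+-commutativeSemigroup using () renaming (interchange to ℤ+-interchange)

open ≡-Reasoning

≡⇒≡ᵇ≡true : ∀ {m n} → m ≡ n → (m ≡ᵇ n) ≡ true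
≡⇒≡ᵇ≡true {m} {n} = dec-true (m ≟ n)

≢⇒≡ᵇ≡false : ∀ {m n} → m ≢ n → (m ≡ᵇ n) ≡ false
≢⇒≡ᵇ≡false {m} {n} = dec-false (m ≟ n)

≡ᵇ≡true⇒≡ : ∀ {m n} → (m ≡ᵇ n) ≡ true → m ≡ n
≡ᵇ≡true⇒≡ {m} {n} eq = ≡ᵇ⇒≡ m n (subst T (sym eq) _)

<⇒<ᵇ≡true : ∀ {m n} → m < n → (m <ᵇ n) ≡ true
<⇒<ᵇ≡true {m} {n} = dec-true (m <? n)

≮⇒<ᵇ≡false : ∀ {m n} → ¬ m < n → (m <ᵇ n) ≡ false
≮⇒<ᵇ≡false {m} {n} = dec-false (m <? n)

sumℤ-cong : ∀ s {f g : Fin s → ℤ} → (∀ k → f k ≡ g k) → sumℤ s f ≡ sumℤ s g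
sumℤ-cong zero    f≗g = refl
sumℤ-cong (suc s) f≗g = cong₂ ℤ._+_ (f≗g zero) (sumℤ-cong s (f≗g ∘ suc))

sumℤ-distrib-+ : ∀ s (f g : Fin s → ℤ) → sumℤ s (λ k → f k ℤ.+ g k) ≡ sumℤ s f ℤ.+ sumℤ s g
sumℤ-distrib-+ zero    f g = refl
sumℤ-distrib-+ (suc s) f g =
  trans (cong (λ t → (f zero ℤ.+ g zero) ℤ.+ t) (sumℤ-distrib-+ s (f ∘ suc) (g ∘ suc)))
        (ℤ+-interchange (f zero) (g zero) _ _)

sumℤ-distrib-− : ∀ s (f g : Fin s → ℤ) → sumℤ s (λ k → f k ℤ.- g k) ≡ sumℤ s f ℤ.- sumℤ s g
sumℤ-distrib-− zero    f g = refl
sumℤ-distrib-− (suc s) f g =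
  trans (cong (λ t → (f zero ℤ.- g zero) ℤ.+ t) (sumℤ-distrib-− s (f ∘ suc) (g ∘ suc)))
        (interchange (f zero) (g zero) _ _)
  where
  interchange : ∀ a b c d → (a ℤ.- b) ℤ.+ (c ℤ.- d) ≡ (a ℤ.+ c) ℤ.- (b ℤ.+ d)
  interchange = solve-∀

sumℤ-pos : ∀ s (f : Fin s → ℕ) → sumℤ s (λ k → + f k) ≡ + sumℕ s f
sumℤ-pos zero    f = refl
sumℤ-pos (suc s) f = trans (cong (λ t → + f zero ℤ.+ t) (sumℤ-pos s (f ∘ suc)))
                           (sym (ℤP.pos-+ (f zero) (sumℕ s (f ∘ suc))))

sumℤ-zero : ∀ s → sumℤ s (λ _ → + 0) ≡ + 0
sumℤ-zero zero    = refl
sumℤ-zero (suc s) = trans (ℤP.+-identityˡ _) (sumℤ-zero s)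

sumℤ-select : ∀ s (i : Fin s) (c : ℤ) (g : Fin s → ℤ) →
  sumℤ s (λ k → (if i == k then c else + 0) ℤ.* g k) ≡ c ℤ.* g i
sumℤ-select (suc s) zero    c g = trans (cong (λ t → c ℤ.* g zero ℤ.+ t) (sumℤ-zero s)) (ℤP.+-identityʳ _)
sumℤ-select (suc s) (suc i) c g = trans (ℤP.+-identityˡ _) (sumℤ-select s i c (g ∘ suc))

cancel-summand⇔ : ∀ t c p c′ p′ → ((t ℤ.+ c) ℤ.- p ≡ (t ℤ.+ c′) ℤ.- p′) ⇔ (c ℤ.+ p′ ≡ c′ ℤ.+ p)
cancel-summand⇔ t c p c′ p′ = mk⇔
  (λ eq → begin
    c ℤ.+ p′                                   ≡⟨ regroup t c p p′ ⟩
    ((t ℤ.+ c) ℤ.- p) ℤ.+ ((p ℤ.+ p′) ℤ.- t)   ≡⟨ cong (ℤ._+ ((p ℤ.+ p′) ℤ.- t)) eq ⟩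
    ((t ℤ.+ c′) ℤ.- p′) ℤ.+ ((p ℤ.+ p′) ℤ.- t) ≡⟨ regroup′ t c′ p p′ ⟩
    c′ ℤ.+ p                                   ∎)
  (λ eq → begin
    (t ℤ.+ c) ℤ.- p                            ≡⟨ unshift t c p p′ ⟩
    (c ℤ.+ p′) ℤ.+ ((t ℤ.- p) ℤ.- p′)          ≡⟨ cong (ℤ._+ ((t ℤ.- p) ℤ.- p′)) eq ⟩
    (c′ ℤ.+ p) ℤ.+ ((t ℤ.- p) ℤ.- p′)          ≡⟨ unshift′ t c′ p p′ ⟩
    (t ℤ.+ c′) ℤ.- p′                          ∎)
  where
  regroup : ∀ t c p p′ → c ℤ.+ p′ ≡ ((t ℤ.+ c) ℤ.- p) ℤ.+ ((p ℤ.+ p′) ℤ.- t)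
  regroup = solve-∀
  regroup′ : ∀ t c′ p p′ → ((t ℤ.+ c′) ℤ.- p′) ℤ.+ ((p ℤ.+ p′) ℤ.- t) ≡ c′ ℤ.+ p
  regroup′ = solve-∀
  unshift : ∀ t c p p′ → (t ℤ.+ c) ℤ.- p ≡ (c ℤ.+ p′) ℤ.+ ((t ℤ.- p) ℤ.- p′)
  unshift = solve-∀
  unshift′ : ∀ t c′ p p′ → (c′ ℤ.+ p) ℤ.+ ((t ℤ.- p) ℤ.- p′) ≡ (t ℤ.+ c′) ℤ.- p′
  unshift′ = solve-∀

pos-+-*-+-* : ∀ c k x l y → + (c + (k * x + l * y)) ≡ + c ℤ.+ (+ k ℤ.* + x ℤ.+ + l ℤ.* + y)
pos-+-*-+-* c k x l y = begin
  + (c + (k * x + l * y))                   ≡⟨ ℤP.pos-+ c _ ⟩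
  + c ℤ.+ + (k * x + l * y)                 ≡⟨ cong (λ t → + c ℤ.+ t) (ℤP.pos-+ (k * x) _) ⟩
  + c ℤ.+ (+ (k * x) ℤ.+ + (l * y))         ≡⟨ cong (λ t → + c ℤ.+ t) (cong₂ ℤ._+_ (ℤP.pos-* k x) (ℤP.pos-* l y)) ⟩
  + c ℤ.+ (+ k ℤ.* + x ℤ.+ + l ℤ.* + y)     ∎

NormalityEquation : (cout cin dᵢ dⱼ aᵢⱼ aⱼᵢ : ℕ) → Set
NormalityEquation cout cin dᵢ dⱼ aᵢⱼ aⱼᵢ = cout + (dᵢ * aᵢⱼ + dⱼ * aⱼᵢ) ≡ cin + (dᵢ * aⱼᵢ + dⱼ * aᵢⱼ)

NormalityEquation-intro : ∀ {cout cin dᵢ dⱼ aᵢⱼ aⱼᵢ} → cout ≡ cin → dᵢ ≡ dⱼ ⊎ aᵢⱼ ≡ aⱼᵢ →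
  NormalityEquation cout cin dᵢ dⱼ aᵢⱼ aⱼᵢ
NormalityEquation-intro {cout} {dⱼ = dⱼ} {aᵢⱼ} {aⱼᵢ} refl (inj₁ refl) =
  cong (λ t → cout + t) (+-comm (dⱼ * aᵢⱼ) (dⱼ * aⱼᵢ))
NormalityEquation-intro refl (inj₂ refl) = refl

module Laplacian (G : Digraph) where

  a : Fin (size G) → Fin (size G) → ℕ
  a i j = b2n (adj G i j)

  d : Fin (size G) → ℕ
  d = outdeg G

  D : Matrix (size G)
  D i j = if i == j then + d i else + 0

  commonOut commonIn : Fin (size G) → Fin (size G) → ℕ
  commonOut i j = sumℕ (size G) (λ k → a i k * a j k)
  commonIn  i j = sumℕ (size G) (λ k → a k i * a k j)

  L : Matrix (size G)
  L = laplacian G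

  D-sym : ∀ i j → (if j == i then + d j else + 0) ≡ D i j
  D-sym i j with i Fin.≟ j
  ... | yes refl = refl
  ... | no  i≢j  rewrite ≢⇒≡ᵇ≡false (i≢j ∘ Fin.toℕ-injective)
                       | ≢⇒≡ᵇ≡false (i≢j ∘ sym ∘ Fin.toℕ-injective) = refl

  product-expansion : ∀ i j (u v : Fin (size G) → ℕ) →
    sumℤ (size G) (λ k → (D i k ℤ.- + u k) ℤ.* (D j k ℤ.- + v k))
      ≡ (+ d i ℤ.* D j i ℤ.+ + sumℕ (size G) (λ k → u k * v k))
        ℤ.- (+ d i ℤ.* + v i ℤ.+ + d j ℤ.* + u j)
  product-expansion i j u v = begin
    Σ (λ k → (D i k ℤ.- + u k) ℤ.* (D j k ℤ.- + v k))
      ≡⟨ sumℤ-cong s (λ k → expand (D i k) (+ u k) (D j k) (+ v k)) ⟩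
    Σ (λ k → (D i k ℤ.* D j k ℤ.+ + u k ℤ.* + v k) ℤ.- (D i k ℤ.* + v k ℤ.+ D j k ℤ.* + u k))
      ≡⟨ sumℤ-distrib-− s _ _ ⟩
    Σ (λ k → D i k ℤ.* D j k ℤ.+ + u k ℤ.* + v k) ℤ.- Σ (λ k → D i k ℤ.* + v k ℤ.+ D j k ℤ.* + u k)
      ≡⟨ cong₂ ℤ._-_ (sumℤ-distrib-+ s _ _) (sumℤ-distrib-+ s _ _) ⟩
    (Σ (λ k → D i k ℤ.* D j k) ℤ.+ Σ (λ k → + u k ℤ.* + v k))
      ℤ.- (Σ (λ k → D i k ℤ.* + v k) ℤ.+ Σ (λ k → D j k ℤ.* + u k))
      ≡⟨ cong₂ ℤ._-_ (cong₂ ℤ._+_ (sumℤ-select s i (+ d i) (D j)) uv)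
                     (cong₂ ℤ._+_ (sumℤ-select s i (+ d i) (+_ ∘ v)) (sumℤ-select s j (+ d j) (+_ ∘ u))) ⟩
    (+ d i ℤ.* D j i ℤ.+ + sumℕ s (λ k → u k * v k)) ℤ.- (+ d i ℤ.* + v i ℤ.+ + d j ℤ.* + u j)
      ∎
    where
    s : ℕ
    s = size G
    Σ : (Fin s → ℤ) → ℤ
    Σ = sumℤ s
    expand : ∀ x y z w → (x ℤ.- y) ℤ.* (z ℤ.- w) ≡ (x ℤ.* z ℤ.+ y ℤ.* w) ℤ.- (x ℤ.* w ℤ.+ z ℤ.* y)
    expand = solve-∀
    uv : Σ (λ k → + u k ℤ.* + v k) ≡ + sumℕ s (λ k → u k * v k)
    uv = trans (sumℤ-cong s (λ k → sym (ℤP.pos-* (u k) (v k)))) (sumℤ-pos s _)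

  LLᵀ-entry : ∀ i j → (L ⊗ transpose L) i j
    ≡ (+ d i ℤ.* D j i ℤ.+ + commonOut i j) ℤ.- (+ d i ℤ.* + a j i ℤ.+ + d j ℤ.* + a i j)
  LLᵀ-entry i j = product-expansion i j (a i) (a j)

  LᵀL-entry : ∀ i j → (transpose L ⊗ L) i j
    ≡ (+ d i ℤ.* D j i ℤ.+ + commonIn i j) ℤ.- (+ d i ℤ.* + a i j ℤ.+ + d j ℤ.* + a j i)
  LᵀL-entry i j = trans
    (sumℤ-cong (size G) (λ k → cong₂ (λ x y → (x ℤ.- + a k i) ℤ.* (y ℤ.- + a k j)) (D-sym i k) (D-sym j k)))
    (product-expansion i j (λ k → a k i) (λ k → a k j))

  NormalAt : Fin (size G) → Fin (size G) → Set
  NormalAt i j = NormalityEquation (commonOut i j) (commonIn i j) (d i) (d j) (a i j) (a j i)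

  entries-agree⇔NormalAt : ∀ i j → ((L ⊗ transpose L) i j ≡ (transpose L ⊗ L) i j) ⇔ NormalAt i j
  entries-agree⇔NormalAt i j = mk⇔
    (λ eq → ℤP.+-injective (begin
      + (commonOut i j + (d i * a i j + d j * a j i))
        ≡⟨ liftOut ⟩
      + commonOut i j ℤ.+ (+ d i ℤ.* + a i j ℤ.+ + d j ℤ.* + a j i)
        ≡⟨ Equivalence.to shift (trans (sym (LLᵀ-entry i j)) (trans eq (LᵀL-entry i j))) ⟩
      + commonIn i j ℤ.+ (+ d i ℤ.* + a j i ℤ.+ + d j ℤ.* + a i j)
        ≡⟨ sym liftIn ⟩
      + (commonIn i j + (d i * a j i + d j * a i j))
        ∎))
    (λ normalAt → begin
      (L ⊗ transpose L) i j
        ≡⟨ LLᵀ-entry i j ⟩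
      (+ d i ℤ.* D j i ℤ.+ + commonOut i j) ℤ.- (+ d i ℤ.* + a j i ℤ.+ + d j ℤ.* + a i j)
        ≡⟨ Equivalence.from shift (trans (sym liftOut) (trans (cong +_ normalAt) liftIn)) ⟩
      (+ d i ℤ.* D j i ℤ.+ + commonIn i j) ℤ.- (+ d i ℤ.* + a i j ℤ.+ + d j ℤ.* + a j i)
        ≡⟨ sym (LᵀL-entry i j) ⟩
      (transpose L ⊗ L) i j
        ∎)
    where
    shift : ((+ d i ℤ.* D j i ℤ.+ + commonOut i j) ℤ.- (+ d i ℤ.* + a j i ℤ.+ + d j ℤ.* + a i j)
              ≡ (+ d i ℤ.* D j i ℤ.+ + commonIn i j) ℤ.- (+ d i ℤ.* + a i j ℤ.+ + d j ℤ.* + a j i))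
          ⇔ (+ commonOut i j ℤ.+ (+ d i ℤ.* + a i j ℤ.+ + d j ℤ.* + a j i)
              ≡ + commonIn i j ℤ.+ (+ d i ℤ.* + a j i ℤ.+ + d j ℤ.* + a i j))
    shift = cancel-summand⇔ (+ d i ℤ.* D j i) (+ commonOut i j) (+ d i ℤ.* + a j i ℤ.+ + d j ℤ.* + a i j)
                           (+ commonIn i j) (+ d i ℤ.* + a i j ℤ.+ + d j ℤ.* + a j i)
    liftOut : + (commonOut i j + (d i * a i j + d j * a j i))
              ≡ + commonOut i j ℤ.+ (+ d i ℤ.* + a i j ℤ.+ + d j ℤ.* + a j i)
    liftOut = pos-+-*-+-* (commonOut i j) (d i) (a i j) (d j) (a j i)
    liftIn : + (commonIn i j + (d i * a j i + d j * a i j))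
             ≡ + commonIn i j ℤ.+ (+ d i ℤ.* + a j i ℤ.+ + d j ℤ.* + a i j)
    liftIn  = pos-+-*-+-* (commonIn i j) (d i) (a j i) (d j) (a i j)

  Normal⇔NormalAt : Normal G ⇔ (∀ i j → NormalAt i j)
  Normal⇔NormalAt = mk⇔
    (λ normal i j → Equivalence.to (entries-agree⇔NormalAt i j) (normal i j))
    (λ normalAt i j → Equivalence.from (entries-agree⇔NormalAt i j) (normalAt i j))

sumBelow : ℕ → (ℕ → ℕ) → ℕ
sumBelow zero    f = 0
sumBelow (suc n) f = f 0 + sumBelow n (f ∘ suc)

sumBelow-cong : ∀ n {f g} → (∀ k → k < n → f k ≡ g k) → sumBelow n f ≡ sumBelow n g
sumBelow-cong zero    f≗g = refl
sumBelow-cong (suc n) f≗g = cong₂ _+_ (f≗g 0 (s≤s z≤n)) (sumBelow-cong n (λ k k<n → f≗g (suc k) (s≤s k<n)))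

sumℕ≡sumBelow : ∀ {s S} → s ≡ S → (f : Fin s → ℕ) (g : ℕ → ℕ) → (∀ k → f k ≡ g (toℕ k)) → sumℕ s f ≡ sumBelow S g
sumℕ≡sumBelow {zero}  refl f g f≗g = refl
sumℕ≡sumBelow {suc s} refl f g f≗g = cong₂ _+_ (f≗g zero) (sumℕ≡sumBelow refl (f ∘ suc) (g ∘ suc) (f≗g ∘ suc))

sumBelow-zero : ∀ n → sumBelow n (λ _ → 0) ≡ 0
sumBelow-zero zero    = refl
sumBelow-zero (suc n) = sumBelow-zero n

sumBelow-split : ∀ a b (f : ℕ → ℕ) → sumBelow (a + b) f ≡ sumBelow a f + sumBelow b (λ k → f (a + k))
sumBelow-split zero    b f = refl
sumBelow-split (suc a) b f = trans (cong (λ t → f 0 + t) (sumBelow-split a b (f ∘ suc))) (sym (+-assoc (f 0) _ _))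

sumBelow-distrib-+ : ∀ n (f g : ℕ → ℕ) → sumBelow n (λ k → f k + g k) ≡ sumBelow n f + sumBelow n g
sumBelow-distrib-+ zero    f g = refl
sumBelow-distrib-+ (suc n) f g =
  trans (cong (λ t → f 0 + g 0 + t) (sumBelow-distrib-+ n (f ∘ suc) (g ∘ suc))) (+-interchange (f 0) (g 0) _ _)

sumBelow-suc : ∀ n (f : ℕ → ℕ) → sumBelow (suc n) f ≡ sumBelow n f + f n
sumBelow-suc n f = begin
  sumBelow (suc n) f                          ≡⟨ cong (λ t → sumBelow t f) (+-comm 1 n) ⟩
  sumBelow (n + 1) f                          ≡⟨ sumBelow-split n 1 f ⟩
  sumBelow n f + (f (n + 0) + 0)              ≡⟨ cong (λ t → sumBelow n f + t) (trans (+-identityʳ _) (cong f (+-identityʳ n))) ⟩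
  sumBelow n f + f n                          ∎

sumBelow-select : ∀ n a (g : ℕ → ℕ) → a < n → sumBelow n (λ k → b2n (k ≡ᵇ a) * g k) ≡ g a
sumBelow-select (suc n) zero    g _ =
  trans (cong (λ t → g 0 + 0 + t) (sumBelow-zero n)) (trans (+-identityʳ _) (+-identityʳ _))
sumBelow-select (suc n) (suc a) g (s≤s a<n) = sumBelow-select n a (g ∘ suc) a<n

module Counts (S : ℕ) (A : ℕ → ℕ → Bool) where

  outCount inCount : ℕ → ℕ
  outCount x = sumBelow S (λ y → b2n (A x y))
  inCount  x = sumBelow S (λ y → b2n (A y x))

  commonOutCount commonInCount : ℕ → ℕ → ℕ
  commonOutCount x x′ = sumBelow S (λ y → b2n (A x y) * b2n (A x′ y))
  commonInCount  x x′ = sumBelow S (λ y → b2n (A y x) * b2n (A y x′))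

  NormalAtCount : ℕ → ℕ → Set
  NormalAtCount x x′ = NormalityEquation (commonOutCount x x′) (commonInCount x x′)
                         (outCount x) (outCount x′) (b2n (A x x′)) (b2n (A x′ x))

  commonOutCount-comm : ∀ x x′ → commonOutCount x x′ ≡ commonOutCount x′ x
  commonOutCount-comm x x′ = sumBelow-cong S (λ y _ → *-comm (b2n (A x y)) (b2n (A x′ y)))

  commonInCount-comm : ∀ x x′ → commonInCount x x′ ≡ commonInCount x′ x
  commonInCount-comm x x′ = sumBelow-cong S (λ y _ → *-comm (b2n (A y x)) (b2n (A y x′)))

module Encoded {G : Digraph} {S : ℕ} {A : ℕ → ℕ → Bool}
               (size≡ : size G ≡ S) (adj≡ : ∀ x y → adj G x y ≡ A (toℕ x) (toℕ y)) where

  open Laplacian G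
  open Counts S A

  outdeg≡ : ∀ x → outdeg G x ≡ outCount (toℕ x)
  outdeg≡ x = sumℕ≡sumBelow size≡ _ (λ y → b2n (A (toℕ x) y)) (λ y → cong b2n (adj≡ x y))

  indeg≡ : ∀ x → indeg G x ≡ inCount (toℕ x)
  indeg≡ x = sumℕ≡sumBelow size≡ _ (λ y → b2n (A y (toℕ x))) (λ y → cong b2n (adj≡ y x))

  NormalAt⇔NormalAtCount : ∀ i j → NormalAt i j ⇔ NormalAtCount (toℕ i) (toℕ j)
  NormalAt⇔NormalAtCount i j
    rewrite sumℕ≡sumBelow size≡ (λ k → a i k * a j k) (λ y → b2n (A (toℕ i) y) * b2n (A (toℕ j) y))
              (λ k → cong₂ (λ u v → b2n u * b2n v) (adj≡ i k) (adj≡ j k))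
          | sumℕ≡sumBelow size≡ (λ k → a k i * a k j) (λ y → b2n (A y (toℕ i)) * b2n (A y (toℕ j)))
              (λ k → cong₂ (λ u v → b2n u * b2n v) (adj≡ k i) (adj≡ k j))
          | outdeg≡ i | outdeg≡ j | adj≡ i j | adj≡ j i = mk⇔ (λ e → e) (λ e → e)

  toℕ<S : ∀ i → toℕ i < S
  toℕ<S i = subst (toℕ i <_) size≡ (toℕ<n i)

  balanced : (∀ x → x < S → inCount x ≡ outCount x) → Balanced G
  balanced in≡out i = trans (indeg≡ i) (trans (in≡out (toℕ i) (toℕ<S i)) (sym (outdeg≡ i)))

  normal : (∀ x x′ → x < S → x′ < S → NormalAtCount x x′) → Normal G
  normal normalAt = Equivalence.from Normal⇔NormalAt (λ i j →
    Equivalence.from (NormalAt⇔NormalAtCount i j) (normalAt _ _ (toℕ<S i) (toℕ<S j)))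

  not-normal : ∀ {x x′} → x < S → x′ < S → ¬ NormalAtCount x x′ → ¬ Normal G
  not-normal {x} {x′} x<S x′<S ¬normalAt normal-G = ¬normalAt
    (subst₂ NormalAtCount (toℕ-fromℕ< x<s) (toℕ-fromℕ< x′<s)
      (Equivalence.to (NormalAt⇔NormalAtCount (fromℕ< x<s) (fromℕ< x′<s))
        (Equivalence.to Normal⇔NormalAt normal-G (fromℕ< x<s) (fromℕ< x′<s))))
    where
    x<s : x < size G
    x<s = subst (x <_) (sym size≡) x<S
    x′<s : x′ < size G
    x′<s = subst (x′ <_) (sym size≡) x′<S

coneAdj : ℕ → (ℕ → ℕ → Bool) → (ℕ → Bool) → ℕ → ℕ → Bool
coneAdj S A μ x y =
  if x ≡ᵇ S then (if y ≡ᵇ S then false else μ y) else (if y ≡ᵇ S then μ x else A x y)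

module Cone (S : ℕ) (A : ℕ → ℕ → Bool) (μ : ℕ → Bool) where

  C : ℕ → ℕ → Bool
  C = coneAdj S A μ

  C-inner : ∀ {x y} → x < S → y < S → C x y ≡ A x y
  C-inner x<S y<S rewrite ≢⇒≡ᵇ≡false (<⇒≢ x<S) | ≢⇒≡ᵇ≡false (<⇒≢ y<S) = refl

  C-to-apex : ∀ {x} → x < S → C x S ≡ μ x
  C-to-apex x<S rewrite ≢⇒≡ᵇ≡false (<⇒≢ x<S) | ≡⇒≡ᵇ≡true {S} refl = refl

  C-from-apex : ∀ {y} → y < S → C S y ≡ μ y
  C-from-apex y<S rewrite ≢⇒≡ᵇ≡false (<⇒≢ y<S) | ≡⇒≡ᵇ≡true {S} refl = refl

  C-apex-irreflexive : C S S ≡ false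
  C-apex-irreflexive rewrite ≡⇒≡ᵇ≡true {S} refl = refl

  C-apex-symmetric : ∀ y → C S y ≡ C y S
  C-apex-symmetric y rewrite ≡⇒≡ᵇ≡true {S} refl with y ≡ᵇ S
  ... | true  = refl
  ... | false = refl

  module Inner = Counts S A
  open Counts (suc S) C

  outCount-inner : ∀ {x} → x < S → outCount x ≡ Inner.outCount x + b2n (μ x)
  outCount-inner {x} x<S = trans (sumBelow-suc S _) (cong₂ _+_
    (sumBelow-cong S (λ y y<S → cong b2n (C-inner x<S y<S))) (cong b2n (C-to-apex x<S)))

  commonOutCount-inner : ∀ {x x′} → x < S → x′ < S →
    commonOutCount x x′ ≡ Inner.commonOutCount x x′ + b2n (μ x) * b2n (μ x′)
  commonOutCount-inner x<S x′<S = trans (sumBelow-suc S _) (cong₂ _+_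
    (sumBelow-cong S (λ y y<S → cong₂ (λ u v → b2n u * b2n v) (C-inner x<S y<S) (C-inner x′<S y<S)))
    (cong₂ (λ u v → b2n u * b2n v) (C-to-apex x<S) (C-to-apex x′<S)))

  commonInCount-inner : ∀ {x x′} → x < S → x′ < S →
    commonInCount x x′ ≡ Inner.commonInCount x x′ + b2n (μ x) * b2n (μ x′)
  commonInCount-inner x<S x′<S = trans (sumBelow-suc S _) (cong₂ _+_
    (sumBelow-cong S (λ y y<S → cong₂ (λ u v → b2n u * b2n v) (C-inner y<S x<S) (C-inner y<S x′<S)))
    (cong₂ (λ u v → b2n u * b2n v) (C-from-apex x<S) (C-from-apex x′<S)))

  commonOutCount-apex : ∀ {x} → x < S → commonOutCount S x ≡ sumBelow S (λ y → b2n (μ y) * b2n (A x y))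
  commonOutCount-apex {x} x<S = trans (sumBelow-suc S _) (trans (cong₂ _+_
    (sumBelow-cong S (λ y y<S → cong₂ (λ u v → b2n u * b2n v) (C-from-apex y<S) (C-inner x<S y<S)))
    (cong (λ u → b2n u * b2n (C x S)) C-apex-irreflexive)) (+-identityʳ _))

  commonInCount-apex : ∀ {x} → x < S → commonInCount S x ≡ sumBelow S (λ y → b2n (μ y) * b2n (A y x))
  commonInCount-apex {x} x<S = trans (sumBelow-suc S _) (trans (cong₂ _+_
    (sumBelow-cong S (λ y y<S → cong₂ (λ u v → b2n u * b2n v) (C-to-apex y<S) (C-inner y<S x<S)))
    (cong (λ u → b2n u * b2n (C S x)) C-apex-irreflexive)) (+-identityʳ _))

  cone-normal : ∀ δ → (∀ x → x < S → Inner.outCount x + b2n (μ x) ≡ δ) →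
    (∀ x x′ → x < S → x′ < S → Inner.commonOutCount x x′ ≡ Inner.commonInCount x x′) →
    (∀ x → x < S → sumBelow S (λ y → b2n (μ y) * b2n (A x y)) ≡ sumBelow S (λ y → b2n (μ y) * b2n (A y x))) →
    ∀ x x′ → x < suc S → x′ < suc S → NormalAtCount x x′
  cone-normal δ regular inner-common marked-common x x′ x<1+S x′<1+S =
    NormalityEquation-intro (common (m<1+n⇒m<n∨m≡n x<1+S) (m<1+n⇒m<n∨m≡n x′<1+S))
                            (degree-or-symmetric (m<1+n⇒m<n∨m≡n x<1+S) (m<1+n⇒m<n∨m≡n x′<1+S))
    where
    common-apex : ∀ {x} → x < S → commonOutCount S x ≡ commonInCount S x
    common-apex x<S = trans (commonOutCount-apex x<S) (trans (marked-common _ x<S) (sym (commonInCount-apex x<S)))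

    common : x < S ⊎ x ≡ S → x′ < S ⊎ x′ ≡ S → commonOutCount x x′ ≡ commonInCount x x′
    common (inj₁ x<S)  (inj₁ x′<S) = begin
      commonOutCount x x′                                     ≡⟨ commonOutCount-inner x<S x′<S ⟩
      Inner.commonOutCount x x′ + b2n (μ x) * b2n (μ x′)      ≡⟨ cong (_+ b2n (μ x) * b2n (μ x′)) (inner-common _ _ x<S x′<S) ⟩
      Inner.commonInCount x x′ + b2n (μ x) * b2n (μ x′)       ≡⟨ sym (commonInCount-inner x<S x′<S) ⟩
      commonInCount x x′                                      ∎
    common (inj₂ refl) (inj₁ x′<S) = common-apex x′<S
    common (inj₁ x<S)  (inj₂ refl) =
      trans (commonOutCount-comm x S) (trans (common-apex x<S) (commonInCount-comm S x))
    common (inj₂ refl) (inj₂ refl) =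
      sumBelow-cong (suc S) (λ y _ → cong (λ u → b2n u * b2n u) (C-apex-symmetric y))

    degree-or-symmetric : x < S ⊎ x ≡ S → x′ < S ⊎ x′ ≡ S → outCount x ≡ outCount x′ ⊎ b2n (C x x′) ≡ b2n (C x′ x)
    degree-or-symmetric (inj₁ x<S) (inj₁ x′<S) =
      inj₁ (trans (outCount-inner x<S) (trans (regular _ x<S) (sym (trans (outCount-inner x′<S) (regular _ x′<S)))))
    degree-or-symmetric (inj₂ refl) _ = inj₂ (cong b2n (C-apex-symmetric x′))
    degree-or-symmetric _ (inj₂ refl) = inj₂ (cong b2n (sym (C-apex-symmetric x)))

-- The loop `go` of `splitAll` is local to its where-block and cannot be named.  `loop` is that
-- function, recovered by unification from one unfolding of `splitAll`; its list argument is the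
-- (unused) parameter of the where-block.
mutual
  private
    loop : (G : Digraph) → List (Fin (size G)) → (s : ℕ) → (Fin s → Fin s → Bool) → (Fin s → Bool) →
           (Fin (size G) → Fin s) → List (Fin (size G)) → Marked
    loop = _

  splitAll-∷ : ∀ G w ws → splitAll G (w ∷ ws)
    ≡ loop G (w ∷ ws) (ℕ.suc (size G)) (adj (twinSplit G w)) (proj₂ (splitMark (G , λ _ → false) w)) inject₁ ws
  splitAll-∷ G w ws
    with w ∷ ws | ℕ.suc (size G) | adj (twinSplit G w) | proj₂ (splitMark (G , λ _ → false) w) | inject₁ {size G}
  ... | W | s | A | M | e = refl

splitLoop : (G : Digraph) → List (Fin (size G)) → (H : Marked) → (Fin (size G) → Fin (size (proj₁ H))) →
            List (Fin (size G)) → Marked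
splitLoop G W H = loop G W (size (proj₁ H)) (adj (proj₁ H)) (proj₂ H)

splitAll≡splitLoop : ∀ G ws → splitAll G ws ≡ splitLoop G ws (G , λ _ → false) (λ v → v) ws
splitAll≡splitLoop G []       = refl
splitAll≡splitLoop G (w ∷ ws) = splitAll-∷ G w ws

Enumerates : (ℕ → ℕ) → ℕ → List ℕ → Set
Enumerates f s []       = ⊤
Enumerates f s (p ∷ ps) = f s ≡ p × Enumerates f (suc s) ps

module Blowup (B : ℕ → ℕ → Bool) where

  Represents : (ℕ → ℕ) → (ℕ → Bool) → Marked → Set
  Represents π μ H = (∀ x y → adj (proj₁ H) x y ≡ B (π (toℕ x)) (π (toℕ y))) × (∀ x → proj₂ H x ≡ μ (toℕ x))

  splitMark-represents : ∀ H w {π π′ μ μ′} → Represents π μ H → B (π (toℕ w)) (π (toℕ w)) ≡ false →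
    (∀ x → x < size (proj₁ H) → π′ x ≡ π x) → π′ (size (proj₁ H)) ≡ π (toℕ w) →
    (∀ x → x < size (proj₁ H) → μ′ x ≡ (μ x ∨ (x ≡ᵇ toℕ w))) → μ′ (size (proj₁ H)) ≡ true →
    Represents π′ μ′ (splitMark H w)
  splitMark-represents (G , M) w {π} {π′} {μ′ = μ′} (adj≡ , mark≡) irrefl π′-old π′-new μ′-old μ′-new =
    adj′≡ , mark′≡
    where
    π′-inject : ∀ a → π′ (toℕ (inject₁ a)) ≡ π (toℕ a)
    π′-inject a = trans (cong π′ (toℕ-inject₁ a)) (π′-old _ (toℕ<n a))
    π′-copy : π′ (toℕ (fromℕ (size G))) ≡ π (toℕ w)
    π′-copy = trans (cong π′ (toℕ-fromℕ _)) π′-new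
    adj′≡ : ∀ x y → adj (twinSplit G w) x y ≡ B (π′ (toℕ x)) (π′ (toℕ y))
    adj′≡ x y with view (size G) x | view (size G) y
    ... | old a | old b = trans (adj≡ a b) (sym (cong₂ B (π′-inject a) (π′-inject b)))
    ... | old a | new   = trans (adj≡ a w) (sym (cong₂ B (π′-inject a) π′-copy))
    ... | new   | old b = trans (adj≡ w b) (sym (cong₂ B π′-copy (π′-inject b)))
    ... | new   | new   = trans (sym irrefl) (sym (cong₂ B π′-copy π′-copy))
    mark′≡ : ∀ x → proj₂ (splitMark (G , M) w) x ≡ μ′ (toℕ x)
    mark′≡ x with view (size G) x
    ... | old a = trans (cong (_∨ (a == w)) (mark≡ a))
                        (sym (trans (cong μ′ (toℕ-inject₁ a)) (μ′-old _ (toℕ<n a))))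
    ... | new   = sym (trans (cong μ′ (toℕ-fromℕ _)) μ′-new)

  addCone-represents : ∀ H {S π μ} → size (proj₁ H) ≡ S → Represents π μ H →
    ∀ x y → adj (addCone H) x y ≡ coneAdj S (λ p q → B (π p) (π q)) μ (toℕ x) (toℕ y)
  addCone-represents (G , M) refl (adj≡ , mark≡) x y with view (size G) x | view (size G) y
  ... | old a | old b rewrite toℕ-inject₁ a | toℕ-inject₁ b
                            | ≢⇒≡ᵇ≡false (<⇒≢ (toℕ<n a)) | ≢⇒≡ᵇ≡false (<⇒≢ (toℕ<n b)) = adj≡ a b
  ... | old a | new   rewrite toℕ-inject₁ a | toℕ-fromℕ (size G)
                            | ≢⇒≡ᵇ≡false (<⇒≢ (toℕ<n a)) | ≡⇒≡ᵇ≡true {size G} refl = mark≡ a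
  ... | new   | old b rewrite toℕ-inject₁ b | toℕ-fromℕ (size G)
                            | ≢⇒≡ᵇ≡false (<⇒≢ (toℕ<n b)) | ≡⇒≡ᵇ≡true {size G} refl = mark≡ b
  ... | new   | new   rewrite toℕ-fromℕ (size G) | ≡⇒≡ᵇ≡true {size G} refl = refl

  module _ (G₀ : Digraph) (irrefl : ∀ p → p < size G₀ → B p p ≡ false) where

    splitLoop-represents : ∀ W ws H (e : Fin (size G₀) → Fin (size (proj₁ H))) {π π′ μ μ′} →
      (∀ v → toℕ (e v) ≡ toℕ v) → (∀ v → π (toℕ (e v)) ≡ toℕ v) → Represents π μ H →
      (∀ x → x < size (proj₁ H) → π′ x ≡ π x) → Enumerates π′ (size (proj₁ H)) (map toℕ ws) →
      (∀ x → x < size (proj₁ H) → μ′ x ≡ (μ x ∨ any (x ≡ᵇ_) (map toℕ ws))) →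
      (∀ x → size (proj₁ H) ≤ x → μ′ x ≡ true) →
      size (proj₁ (splitLoop G₀ W H e ws)) ≡ size (proj₁ H) + length ws
        × Represents π′ μ′ (splitLoop G₀ W H e ws)
    splitLoop-represents _ [] _ _ _ _ (adj≡ , mark≡) π′-old _ μ′-old _ =
      sym (+-identityʳ _) ,
      (λ x y → trans (adj≡ x y) (sym (cong₂ B (π′-old _ (toℕ<n x)) (π′-old _ (toℕ<n y))))) ,
      (λ x → trans (mark≡ x) (sym (trans (μ′-old _ (toℕ<n x)) (∨-identityʳ _))))
    splitLoop-represents W (w ∷ ws) H e {π′ = π′} {μ = μ} {μ′ = μ′} toℕ-e π-e rep π′-old (π′-new , π′-rest) μ′-old μ′-new
      with splitLoop-represents W ws (splitMark H (e w)) (inject₁ ∘ e) {π′} {π′} {μ₁} {μ′}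
             (λ v → trans (toℕ-inject₁ (e v)) (toℕ-e v))
             (λ v → trans (cong π′ (toℕ-inject₁ (e v))) (trans (π′-old _ (toℕ<n (e v))) (π-e v)))
             (splitMark-represents H (e w) rep
                (subst (λ p → B p p ≡ false) (sym (π-e w)) (irrefl (toℕ w) (toℕ<n w)))
                π′-old (trans π′-new (sym (π-e w)))
                μ₁-old μ₁-new)
             (λ _ _ → refl) π′-rest μ′-old′ (λ x s<x → μ′-new x (<⇒≤ s<x))
      where
      s : ℕ
      s = size (proj₁ H)
      μ₁ : ℕ → Bool
      μ₁ x = if x <ᵇ s then μ x ∨ (x ≡ᵇ toℕ w) else true
      μ₁-old : ∀ x → x < s → μ₁ x ≡ (μ x ∨ (x ≡ᵇ toℕ (e w)))
      μ₁-old x x<s rewrite <⇒<ᵇ≡true x<s | toℕ-e w = refl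
      μ₁-new : μ₁ s ≡ true
      μ₁-new rewrite ≮⇒<ᵇ≡false (n≮n s) = refl
      μ′-old′ : ∀ x → x < suc s → μ′ x ≡ (μ₁ x ∨ any (x ≡ᵇ_) (map toℕ ws))
      μ′-old′ x (s≤s x≤s) with m≤n⇒m<n∨m≡n x≤s
      ... | inj₁ x<s rewrite <⇒<ᵇ≡true x<s = trans (μ′-old x x<s) (sym (∨-assoc (μ x) _ _))
      ... | inj₂ refl rewrite ≮⇒<ᵇ≡false (n≮n s) = μ′-new s ≤-refl
    ... | size≡ , rep′ = trans size≡ (sym (+-suc (size (proj₁ H)) (length ws))) , rep′

    splitAll-represents : ∀ ws {π μ} → (∀ x y → adj G₀ x y ≡ B (toℕ x) (toℕ y)) →
      (∀ x → x < size G₀ → π x ≡ x) → Enumerates π (size G₀) (map toℕ ws) →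
      (∀ x → x < size G₀ → μ x ≡ any (x ≡ᵇ_) (map toℕ ws)) → (∀ x → size G₀ ≤ x → μ x ≡ true) →
      size (proj₁ (splitAll G₀ ws)) ≡ size G₀ + length ws × Represents π μ (splitAll G₀ ws)
    splitAll-represents ws {π} {μ} adj≡ π-old π-new μ-old μ-new rewrite splitAll≡splitLoop G₀ ws =
      splitLoop-represents ws ws (G₀ , λ _ → false) (λ v → v) {λ x → x} {π} {λ _ → false} {μ}
        (λ _ → refl) (λ _ → refl) (adj≡ , λ _ → refl) π-old π-new μ-old μ-new

double : ℕ → ℕ
double zero    = zero
double (suc k) = suc (suc (double k))

double≡*2 : ∀ k → double k ≡ k * 2
double≡*2 zero    = refl
double≡*2 (suc k) = cong (ℕ.suc ∘ ℕ.suc) (double≡*2 k)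

double-< : ∀ {i j} → i < j → double i < double j
double-< {zero}  {suc j} _         = s≤s z≤n
double-< {suc i} {suc j} (s≤s i<j) = s≤s (s≤s (double-< i<j))

even : ℕ → Bool
even zero    = true
even (suc x) = not (even x)

even-double : ∀ k → even (double k) ≡ true
even-double zero    = refl
even-double (suc k) = trans (not-involutive _) (even-double k)

sumBelow-even : ∀ m (f : ℕ → ℕ) → sumBelow (double m) (λ q → b2n (even q) * f q) ≡ sumBelow m (f ∘ double)
sumBelow-even zero    f = refl
sumBelow-even (suc m) f = cong₂ _+_ (+-identityʳ (f 0)) (begin
  sumBelow (double m) (λ q → b2n (not (not (even q))) * f (suc (suc q)))
    ≡⟨ sumBelow-cong (double m) (λ q _ → cong (λ b → b2n b * f (suc (suc q))) (not-involutive (even q))) ⟩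
  sumBelow (double m) (λ q → b2n (even q) * f (suc (suc q)))
    ≡⟨ sumBelow-even m (f ∘ ℕ.suc ∘ ℕ.suc) ⟩
  sumBelow m (f ∘ double ∘ ℕ.suc)
    ∎)

even-% : ∀ x → (x % 2 ≡ᵇ 0) ≡ even x
even-% zero          = refl
even-% (suc zero)    = refl
even-% (suc (suc x)) = trans (even-% x) (sym (not-involutive (even x)))

map-filterᵇ : ∀ {A : Set} (f : A → ℕ) (P : ℕ → Bool) xs → map f (filterᵇ (P ∘ f) xs) ≡ filterᵇ P (map f xs)
map-filterᵇ f P []       = refl
map-filterᵇ f P (x ∷ xs) with P (f x)
... | true  = cong (f x ∷_) (map-filterᵇ f P xs)
... | false = map-filterᵇ f P xs

map-toℕ-allFin : ∀ n → map toℕ (allFin n) ≡ upTo n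
map-toℕ-allFin n = trans (map-tabulate (λ i → i) toℕ) (tabulate-toℕ n (λ x → x))
  where
  tabulate-toℕ : ∀ n (f : ℕ → ℕ) → tabulate {n = n} (f ∘ toℕ) ≡ applyUpTo f n
  tabulate-toℕ zero    f = refl
  tabulate-toℕ (suc n) f = cong (f 0 ∷_) (tabulate-toℕ n (f ∘ ℕ.suc))

filterᵇ-applyUpTo-double : ∀ m (P : ℕ → Bool) f → (∀ i → P (f i) ≡ even i) →
  filterᵇ P (applyUpTo f (double m)) ≡ applyUpTo (f ∘ double) m
filterᵇ-applyUpTo-double zero    P f P∘f≗even = refl
filterᵇ-applyUpTo-double (suc m) P f P∘f≗even rewrite P∘f≗even 0 | P∘f≗even 1 =
  cong (f 0 ∷_) (filterᵇ-applyUpTo-double m P (f ∘ ℕ.suc ∘ ℕ.suc)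
    (λ i → trans (P∘f≗even (suc (suc i))) (not-involutive (even i))))

any-≡ᵇ-filterᵇ : ∀ x (P : ℕ → Bool) xs → any (x ≡ᵇ_) (filterᵇ P xs) ≡ (P x ∧ any (x ≡ᵇ_) xs)
any-≡ᵇ-filterᵇ x P []       = sym (∧-zeroʳ (P x))
any-≡ᵇ-filterᵇ x P (y ∷ xs) with x ≟ y
... | yes refl with P x in Px
...   | true  rewrite ≡⇒≡ᵇ≡true {x} refl = refl
...   | false = trans (any-≡ᵇ-filterᵇ x P xs) (cong (_∧ _) Px)
any-≡ᵇ-filterᵇ x P (y ∷ xs) | no x≢y with P y
... | true  rewrite ≢⇒≡ᵇ≡false x≢y = any-≡ᵇ-filterᵇ x P xs
... | false rewrite ≢⇒≡ᵇ≡false x≢y = any-≡ᵇ-filterᵇ x P xs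

any-applyUpTo : ∀ (p : ℕ → Bool) f {i n} → i < n → p (f i) ≡ true → any p (applyUpTo f n) ≡ true
any-applyUpTo p f {zero}  {suc n} _         pfi rewrite pfi = refl
any-applyUpTo p f {suc i} {suc n} (s≤s i<n) pfi =
  trans (cong (p (f 0) ∨_) (any-applyUpTo p (f ∘ ℕ.suc) i<n pfi)) (∨-zeroʳ (p (f 0)))

Enumerates-applyUpTo : ∀ {f s} (g : ℕ → ℕ) l → (∀ i → f (s + i) ≡ g i) → Enumerates f s (applyUpTo g l)
Enumerates-applyUpTo g zero    f≗g = _
Enumerates-applyUpTo {f} {s} g (suc l) f≗g =
  trans (cong f (sym (+-identityʳ s))) (f≗g 0) ,
  Enumerates-applyUpTo (g ∘ ℕ.suc) l (λ i → trans (cong f (sym (+-suc s i))) (f≗g (suc i)))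

module Cycle (k : ℕ) where

  -- n = 2(k + 2) ≥ 4, in a form under which next 0, next 1 and prev 0 evaluate.
  m n S : ℕ
  m = suc (suc k)
  n = double m
  S = n + m

  next : ℕ → ℕ
  next p = if suc p ≡ᵇ n then 0 else suc p

  prev : ℕ → ℕ
  prev zero    = ℕ.pred n
  prev (suc p) = p

  next-last : ∀ {p} → suc p ≡ n → next p ≡ 0
  next-last e rewrite ≡⇒≡ᵇ≡true e = refl

  next-inner : ∀ {p} → suc p ≢ n → next p ≡ suc p
  next-inner e rewrite ≢⇒≡ᵇ≡false e = refl

  next-< : ∀ {p} → p < n → next p < n
  next-< {p} p<n with suc p ≟ n
  ... | yes e  rewrite next-last e  = s≤s z≤n
  ... | no  ne rewrite next-inner ne = ≤∧≢⇒< p<n ne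

  prev-< : ∀ {p} → p < n → prev p < n
  prev-< {zero}  _   = ≤-refl
  prev-< {suc p} p<n = ≤-trans (n≤1+n _) p<n

  prev-next : ∀ {p} → p < n → prev (next p) ≡ p
  prev-next {p} p<n with suc p ≟ n
  ... | yes e  rewrite next-last e  = cong ℕ.pred (sym e)
  ... | no  ne rewrite next-inner ne = refl

  next-prev : ∀ {p} → p < n → next (prev p) ≡ p
  next-prev {zero}  _   = next-last refl
  next-prev {suc p} p<n = next-inner (<⇒≢ p<n)

  ≡next⇔≡prev : ∀ {p q} → p < n → q < n → (p ≡ᵇ next q) ≡ (q ≡ᵇ prev p)
  ≡next⇔≡prev {p} {q} p<n q<n = ⇔→≡ {z = true} (mk⇔
    (λ e → ≡⇒≡ᵇ≡true (trans (sym (prev-next q<n)) (cong prev (sym (≡ᵇ≡true⇒≡ {p} e)))))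
    (λ e → ≡⇒≡ᵇ≡true (trans (sym (next-prev p<n)) (cong next (sym (≡ᵇ≡true⇒≡ {q} e))))))

  next-irreflexive : ∀ p → p < n → (p ≡ᵇ next p) ≡ false
  next-irreflexive p p<n with suc p ≟ n
  ... | yes e  rewrite next-last e  = ≢⇒≡ᵇ≡false {p} (λ { refl → contradiction e λ () })
  ... | no  ne rewrite next-inner ne = ≢⇒≡ᵇ≡false (<⇒≢ (n<1+n p))

  even-next : ∀ {p} → p < n → even (next p) ≡ not (even p)
  even-next {p} p<n with suc p ≟ n
  ... | yes e  rewrite next-last e  = sym (trans (cong even e) (even-double m))
  ... | no  ne rewrite next-inner ne = refl

  even-prev : ∀ {p} → p < n → even (prev p) ≡ not (even p)
  even-prev {zero}  _ = cong (not ∘ not ∘ not) (even-double k)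
  even-prev {suc p} _ = sym (not-involutive (even p))

  copies : ℕ → ℕ
  copies q = suc (b2n (even q))

  copies-next≡copies-prev : ∀ {p} → p < n → copies (next p) ≡ copies (prev p)
  copies-next≡copies-prev p<n = cong (suc ∘ b2n) (trans (even-next p<n) (sym (even-prev p<n)))

  copies-next+even≡2 : ∀ {p} → p < n → copies (next p) + b2n (even p) ≡ 2
  copies-next+even≡2 {p} p<n rewrite even-next p<n with even p
  ... | true  = refl
  ... | false = refl

  -- Vertex x < n of Γ′ is the dicycle vertex x, and vertex n + i is the twin of dicycle vertex 2i.
  base : ℕ → ℕ
  base x = if x <ᵇ n then x else double (x ∸ n)

  base-< : ∀ {x} → x < n → base x ≡ x
  base-< x<n rewrite <⇒<ᵇ≡true x<n = refl

  base-n+ : ∀ i → base (n + i) ≡ double i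
  base-n+ i rewrite ≮⇒<ᵇ≡false (m+n≮m n i) | m+n∸m≡n n i = refl

  base-<n : ∀ {x} → x < S → base x < n
  base-<n {x} x<S with x <? n
  ... | yes x<n = subst (_< n) (sym (base-< x<n)) x<n
  ... | no  x≮n = subst (_< n) (sym (trans (cong base (sym n+[x∸n]≡x)) (base-n+ (x ∸ n))))
                        (double-< (+-cancelˡ-< n _ _ (subst (_< S) (sym n+[x∸n]≡x) x<S)))
    where
    n+[x∸n]≡x : n + (x ∸ n) ≡ x
    n+[x∸n]≡x = m+[n∸m]≡n (≮⇒≥ x≮n)

  sumBelow-base : ∀ (F : ℕ → ℕ) → sumBelow S (F ∘ base) ≡ sumBelow n (λ q → copies q * F q)
  sumBelow-base F = begin
    sumBelow S (F ∘ base)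
      ≡⟨ sumBelow-split n m (F ∘ base) ⟩
    sumBelow n (F ∘ base) + sumBelow m (λ i → F (base (n + i)))
      ≡⟨ cong₂ _+_ (sumBelow-cong n (λ q q<n → cong F (base-< q<n))) (sumBelow-cong m (λ i _ → cong F (base-n+ i))) ⟩
    sumBelow n F + sumBelow m (F ∘ double)
      ≡⟨ cong (λ t → sumBelow n F + t) (sym (sumBelow-even m F)) ⟩
    sumBelow n F + sumBelow n (λ q → b2n (even q) * F q)
      ≡⟨ sym (sumBelow-distrib-+ n F (λ q → b2n (even q) * F q)) ⟩
    sumBelow n (λ q → copies q * F q)
      ∎

  sumBelow-base-select : ∀ {a} (F g : ℕ → ℕ) → a < n → (∀ q → q < n → F q ≡ b2n (q ≡ᵇ a) * g q) →
    sumBelow S (F ∘ base) ≡ copies a * g a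
  sumBelow-base-select {a} F g a<n F≗δg = begin
    sumBelow S (F ∘ base)                                ≡⟨ sumBelow-base F ⟩
    sumBelow n (λ q → copies q * F q)                    ≡⟨ sumBelow-cong n regroup ⟩
    sumBelow n (λ q → b2n (q ≡ᵇ a) * (copies q * g q))   ≡⟨ sumBelow-select n a (λ q → copies q * g q) a<n ⟩
    copies a * g a                                       ∎
    where
    regroup : ∀ q → q < n → copies q * F q ≡ b2n (q ≡ᵇ a) * (copies q * g q)
    regroup q q<n = trans (cong (copies q *_) (F≗δg q q<n)) (*-left-comm (copies q) (b2n (q ≡ᵇ a)) (g q))

  arc : ℕ → ℕ → Bool
  arc p q = q ≡ᵇ next p

  A : ℕ → ℕ → Bool
  A x y = arc (base x) (base y)

  marked : ℕ → Bool
  marked x = even (base x)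

  out-sum : ∀ {x} → x < S → (g : ℕ → ℕ) →
    sumBelow S (λ y → b2n (A x y) * g (base y)) ≡ copies (next (base x)) * g (next (base x))
  out-sum x<S g = sumBelow-base-select _ g (next-< (base-<n x<S)) (λ _ _ → refl)

  in-sum : ∀ {x} → x < S → (g : ℕ → ℕ) →
    sumBelow S (λ y → b2n (A y x) * g (base y)) ≡ copies (prev (base x)) * g (prev (base x))
  in-sum x<S g = sumBelow-base-select _ g (prev-< (base-<n x<S))
    (λ q q<n → cong (λ b → b2n b * g q) (≡next⇔≡prev (base-<n x<S) q<n))

  open Counts S A

  outCount≡ : ∀ {x} → x < S → outCount x ≡ copies (next (base x))
  outCount≡ {x} x<S = begin
    sumBelow S (λ y → b2n (A x y))       ≡⟨ sumBelow-cong S (λ y _ → sym (*-identityʳ (b2n (A x y)))) ⟩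
    sumBelow S (λ y → b2n (A x y) * 1)   ≡⟨ out-sum x<S (λ _ → 1) ⟩
    copies (next (base x)) * 1           ≡⟨ *-identityʳ _ ⟩
    copies (next (base x))               ∎

  inCount≡ : ∀ {x} → x < S → inCount x ≡ copies (prev (base x))
  inCount≡ {x} x<S = begin
    sumBelow S (λ y → b2n (A y x))       ≡⟨ sumBelow-cong S (λ y _ → sym (*-identityʳ (b2n (A y x)))) ⟩
    sumBelow S (λ y → b2n (A y x) * 1)   ≡⟨ in-sum x<S (λ _ → 1) ⟩
    copies (prev (base x)) * 1           ≡⟨ *-identityʳ _ ⟩
    copies (prev (base x))               ∎

  inCount≡outCount : ∀ x → x < S → inCount x ≡ outCount x
  inCount≡outCount x x<S =
    trans (inCount≡ x<S) (trans (sym (copies-next≡copies-prev (base-<n x<S))) (sym (outCount≡ x<S)))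

  commonOutCount≡ : ∀ {x x′} → x < S → x′ < S → commonOutCount x x′ ≡ copies (next (base x)) * b2n (base x′ ≡ᵇ base x)
  commonOutCount≡ {x} {x′} x<S x′<S = trans (out-sum x<S (λ q → b2n (q ≡ᵇ next (base x′))))
    (cong (λ b → copies (next (base x)) * b2n b)
      (trans (≡next⇔≡prev (next-< (base-<n x<S)) (base-<n x′<S)) (cong (base x′ ≡ᵇ_) (prev-next (base-<n x<S)))))

  commonInCount≡ : ∀ {x x′} → x < S → x′ < S → commonInCount x x′ ≡ copies (prev (base x)) * b2n (base x′ ≡ᵇ base x)
  commonInCount≡ {x} {x′} x<S x′<S = trans (in-sum x<S (λ q → b2n (base x′ ≡ᵇ next q)))
    (cong (λ p → copies (prev (base x)) * b2n (base x′ ≡ᵇ p)) (next-prev (base-<n x<S)))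

  commonOutCount≡commonInCount : ∀ x x′ → x < S → x′ < S → commonOutCount x x′ ≡ commonInCount x x′
  commonOutCount≡commonInCount x x′ x<S x′<S = begin
    commonOutCount x x′                               ≡⟨ commonOutCount≡ x<S x′<S ⟩
    copies (next (base x)) * b2n (base x′ ≡ᵇ base x)  ≡⟨ cong (_* b2n (base x′ ≡ᵇ base x)) (copies-next≡copies-prev (base-<n x<S)) ⟩
    copies (prev (base x)) * b2n (base x′ ≡ᵇ base x)  ≡⟨ sym (commonInCount≡ x<S x′<S) ⟩
    commonInCount x x′                                ∎

  markedOut≡markedIn : ∀ x → x < S →
    sumBelow S (λ y → b2n (marked y) * b2n (A x y)) ≡ sumBelow S (λ y → b2n (marked y) * b2n (A y x))
  markedOut≡markedIn x x<S = begin
    sumBelow S (λ y → b2n (marked y) * b2n (A x y))   ≡⟨ sumBelow-cong S (λ y _ → *-comm (b2n (marked y)) (b2n (A x y))) ⟩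
    sumBelow S (λ y → b2n (A x y) * b2n (marked y))   ≡⟨ out-sum x<S (b2n ∘ even) ⟩
    copies (next b) * b2n (even (next b))             ≡⟨ cong₂ (λ c e → c * b2n e) (copies-next≡copies-prev b<n)
                                                               (trans (even-next b<n) (sym (even-prev b<n))) ⟩
    copies (prev b) * b2n (even (prev b))             ≡⟨ sym (in-sum x<S (b2n ∘ even)) ⟩
    sumBelow S (λ y → b2n (A y x) * b2n (marked y))   ≡⟨ sumBelow-cong S (λ y _ → *-comm (b2n (A y x)) (b2n (marked y))) ⟩
    sumBelow S (λ y → b2n (marked y) * b2n (A y x))   ∎
    where
    b : ℕ
    b = base x
    b<n : b < n
    b<n = base-<n x<S

  outCount+marked≡2 : ∀ x → x < S → outCount x + b2n (marked x) ≡ 2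
  outCount+marked≡2 x x<S = trans (cong (_+ b2n (marked x)) (outCount≡ x<S)) (copies-next+even≡2 (base-<n x<S))

  oddVertices-toℕ : map toℕ (oddVertices n) ≡ filterᵇ (λ x → x % 2 ≡ᵇ 0) (upTo n)
  oddVertices-toℕ = trans (map-filterᵇ toℕ (λ x → x % 2 ≡ᵇ 0) (allFin n)) (cong (filterᵇ (λ x → x % 2 ≡ᵇ 0)) (map-toℕ-allFin n))

  evens : filterᵇ (λ x → x % 2 ≡ᵇ 0) (upTo n) ≡ applyUpTo double m
  evens = filterᵇ-applyUpTo-double m (λ x → x % 2 ≡ᵇ 0) (λ x → x) even-%

  open Blowup arc

  Γ′-represents : size (Γ' n) ≡ S × Represents base marked (Γ'T n)
  Γ′-represents with splitAll-represents (dicycle n) next-irreflexive (oddVertices n)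
                       (λ _ _ → refl) (λ _ → base-<) enumerates split-old split-new
    where
    enumerates : Enumerates base n (map toℕ (oddVertices n))
    enumerates = subst (Enumerates base n) (sym (trans oddVertices-toℕ evens)) (Enumerates-applyUpTo double m base-n+)
    split-old : ∀ x → x < n → marked x ≡ any (x ≡ᵇ_) (map toℕ (oddVertices n))
    split-old x x<n = sym (begin
      any (x ≡ᵇ_) (map toℕ (oddVertices n))               ≡⟨ cong (any (x ≡ᵇ_)) oddVertices-toℕ ⟩
      any (x ≡ᵇ_) (filterᵇ (λ x → x % 2 ≡ᵇ 0) (upTo n))   ≡⟨ any-≡ᵇ-filterᵇ x (λ y → y % 2 ≡ᵇ 0) (upTo n) ⟩
      (x % 2 ≡ᵇ 0) ∧ any (x ≡ᵇ_) (upTo n)                 ≡⟨ cong ((x % 2 ≡ᵇ 0) ∧_) (any-applyUpTo (x ≡ᵇ_) (λ y → y) x<n (≡⇒≡ᵇ≡true {x} refl)) ⟩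
      (x % 2 ≡ᵇ 0) ∧ true                                 ≡⟨ ∧-identityʳ (x % 2 ≡ᵇ 0) ⟩
      x % 2 ≡ᵇ 0                                          ≡⟨ even-% x ⟩
      even x                                              ≡⟨ cong even (sym (base-< x<n)) ⟩
      marked x                                            ∎)
    split-new : ∀ x → n ≤ x → marked x ≡ true
    split-new x n≤x rewrite ≮⇒<ᵇ≡false (≤⇒≯ n≤x) = even-double (x ∸ n)
  ... | size≡ , represents = trans size≡ (cong (λ l → n + l) length-oddVertices) , represents
    where
    length-oddVertices : length (oddVertices n) ≡ m
    length-oddVertices = trans (sym (length-map toℕ (oddVertices n)))
      (trans (cong length (trans oddVertices-toℕ evens)) (length-applyUpTo double m))

  module Γ′ = Encoded {A = A} (proj₁ Γ′-represents) (proj₁ (proj₂ Γ′-represents))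

  Γ′-balanced : Balanced (Γ' n)
  Γ′-balanced = Γ′.balanced inCount≡outCount

  Γ′-not-normal : ¬ Normal (Γ' n)
  Γ′-not-normal = Γ′.not-normal {0} {1} (s≤s z≤n) (s≤s (s≤s z≤n)) ¬normalAt
    where
    -- The arc 0 → 1 is not reversed, and d₀ = 1, d₁ = 2 because 2 is split but 1 is not.
    ¬normalAt : ¬ NormalAtCount 0 1
    ¬normalAt = violated (commonOutCount≡ (s≤s z≤n) (s≤s (s≤s z≤n)))
                         (trans (commonInCount≡ (s≤s z≤n) (s≤s (s≤s z≤n))) (*-zeroʳ (copies (prev 0))))
                         (outCount≡ (s≤s z≤n)) (outCount≡ (s≤s (s≤s z≤n)))
      where
      violated : ∀ {cout cin d₀ d₁} → cout ≡ 0 → cin ≡ 0 → d₀ ≡ 1 → d₁ ≡ 2 → ¬ NormalityEquation cout cin d₀ d₁ 1 0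
      violated refl refl refl refl ()

  Γ″-normal : Normal (Γ'' n)
  Γ″-normal = Encoded.normal {A = Cone.C S A marked} (cong suc (proj₁ Γ′-represents))
    (addCone-represents (Γ'T n) {π = base} {μ = marked} (proj₁ Γ′-represents) (proj₂ Γ′-represents))
    (Cone.cone-normal S A marked 2 outCount+marked≡2 commonOutCount≡commonInCount markedOut≡markedIn)

theorem3p5 : (n : ℕ) → 4 ≤ n → 2 ∣ n →
    Balanced (Γ' n) × ¬ Normal (Γ' n) × Normal (Γ'' n)
theorem3p5 _ ()             (divides zero refl)
theorem3p5 _ (s≤s (s≤s ())) (divides (suc zero) refl)
theorem3p5 _ _              (divides (suc (suc k)) refl) =
  subst (λ n → Balanced (Γ' n) × ¬ Normal (Γ' n) × Normal (Γ'' n)) (double≡*2 (suc (suc k)))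
    (Γ′-balanced , Γ′-not-normal , Γ″-normal)
  where open Cycle k
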